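{- Let $n\ge 2$ and $k\ge 1$ with $2k\le n$. Let $a_0a_1\cdots a_{2k+1}$ be any Dyck word of length $2(k+1)$ (so $a_0=u$, $a_{2k+1}=d$, and $a_1\cdots a_{2k}$ contains exactly $k$ letters $u$ and $k$ letters $d$). Form the sequence $s_1s_2\cdots s_{2k}$ of alternatives by letting the positions $t\in[2k]$ with $a_t=d$ be filled, in increasing order of $t$, by the elements of $A_{2k}=\{1,2,4,\dots,2k-2\}$ in increasing order, and the positions $t$ with $a_t=u$ be filled, in increasing order of $t$, by the elements of $[2k]\setminus A_{2k}=\{3,5,\dots,2k-1,2k\}$ in increasing order. Then there is an order in the $k$-th part of $D_{[n]}(A_n)$ whose top $2k$ alternatives are $s_1,s_2,\dots,s_{2k}$ in this order.
   Context: A Dyck word of length $2k'$ is a sequence $a_1\cdots a_{2k'}$ of $k'$ letters $u$ and $k'$ letters $d$ such that every prefix contains at least as many $u$'s as $d$'s (here indexed $a_0\cdots a_{2k+1}$ with $k'=k+1$). The set of alternatives is $[n]$ with its natural order. For a triple $i<j<l$, the never condition $1N3$ on a set of linear orders means that in every order, $i$ is not ranked last among $i,j,l$; $3N1$ means that $l$ is not ranked first among $i,j,l$. For $B\subseteq[n]$, $D_{[n]}(B)$ is the set of all linear orders on $[n]$ such that every triple $i<j<l$ satisfies $1N3$ if $j\in B$ and $3N1$ if $j\notin B$. Let $A_n$ consist of $1$ together with the even numbers up to $n-2$ if $n$ is even, and up to $n-1$ if $n$ is odd. The $k$-th part of $D_{[n]}(A_n)$ consists of those orders whose top $2k$ positions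 are occupied exactly by $[2k]$, but whose top $2(k-1)$ positions are not occupied exactly by $[2(k-1)]$ (for $k=1$ the second condition is vacuous). -}

module Defs where

open import Data.Nat using (ℕ; zero; suc; _+_; _*_; _∸_; _≤_; _<_; _%_; _≡ᵇ_; _≤ᵇ_)
open import Data.Bool using (Bool; true; false; _∨_; _∧_; not; if_then_else_; T)
open import Data.List using (List; []; _∷_; _++_; applyUpTo; filterᵇ; take; drop; length; filter)
open import Data.List.Relation.Binary.Permutation.Propositional using (_↭_)
open import Data.Product using (Σ; ∃; _×_; _,_)
open import Data.Sum using (_⊎_)
open import Relation.Nullary using (¬_)
open import Relation.Binary.PropositionalEquality using (_≡_)

range : ℕ → List ℕ
range n = applyUpTo suc n

-- A linear order on [n] is a list of the alternatives ranked from top (first) to bottom (last).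
-- x is ranked above y in σ
Above : List ℕ → ℕ → ℕ → Set
Above σ x y = Σ (List ℕ) λ p → Σ (List ℕ) λ q → Σ (List ℕ) λ r → σ ≡ p ++ x ∷ q ++ y ∷ r

OneN3 : List ℕ → ℕ → ℕ → ℕ → Set
OneN3 σ i j l = Above σ i j ⊎ Above σ i l

ThreeN1 : List ℕ → ℕ → ℕ → ℕ → Set
ThreeN1 σ i j l = Above σ i l ⊎ Above σ j l

IsLinearOrder : ℕ → List ℕ → Set
IsLinearOrder n σ = σ ↭ range n

InD : ℕ → (ℕ → Bool) → List ℕ → Set
InD n B σ = IsLinearOrder n σ ×
  (∀ i j l → 1 ≤ i → i < j → j < l → l ≤ n →
     (if B j then OneN3 σ i j l else ThreeN1 σ i j l))

isEven : ℕ → Bool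
isEven m = (m % 2) ≡ᵇ 0

boundA : ℕ → ℕ
boundA n = if isEven n then n ∸ 2 else n ∸ 1

inA : ℕ → ℕ → Bool
inA n m = (m ≡ᵇ 1) ∨ (isEven m ∧ (2 ≤ᵇ m) ∧ (m ≤ᵇ boundA n))

-- k-th part of D_[n](A_n) (membership in D_[n](A_n) stated separately)
InKthPart : ℕ → List ℕ → Set
InKthPart k σ = (take (2 * k) σ ↭ range (2 * k)) ×
  (2 ≤ k → ¬ (take (2 * (k ∸ 1)) σ ↭ range (2 * (k ∸ 1))))

data Letter : Set where
  u d : Letter

countU : List Letter → ℕ
countU [] = 0
countU (u ∷ w) = suc (countU w)
countU (d ∷ w) = countU w

countD : List Letter → ℕ
countD [] = 0
countD (u ∷ w) = countD w
countD (d ∷ w) = suc (countD w)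

IsDyck : List Letter → Set
IsDyck w = (countU w ≡ countD w) ×
  (∀ p q → w ≡ p ++ q → countD p ≤ countU p)

fill : List Letter → List ℕ → List ℕ → List ℕ
fill [] xs ys = []
fill (d ∷ w) (x ∷ xs) ys = x ∷ fill w xs ys
fill (d ∷ w) [] ys = []
fill (u ∷ w) xs (y ∷ ys) = y ∷ fill w xs ys
fill (u ∷ w) xs [] = []

listA : ℕ → List ℕ
listA m = filterᵇ (inA m) (range m)

listNotA : ℕ → List ℕ
listNotA m = filterᵇ (λ x → not (inA m x)) (range m)

seqS : ℕ → List Letter → List ℕ
seqS k w = fill (take (2 * k) (drop 1 w)) (listA (2 * k)) (listNotA (2 * k))

{-# OPTIONS --safe #-}
module Submission where

-- Write the Dyck word as u v d and let σ be the filled sequence s followed by 2k+1, …, n.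
-- Inside s the members of A_{2k} appear in increasing order, and so do the non-members; the
-- alternatives above 2k come last in increasing order. Hence every never condition either holds
-- because i is above l, or reduces to: a non-member y precedes every larger member x. That follows
-- from two counts: below each 1 ≤ t < 2k there are more members of A_{2k} than non-members, while
-- every prefix of v has at most one more d than u. Finally 2k−1 is the (k−1)-th non-member and the
-- last two letters of v are not both u, so 2k−1 sits in the top 2k−2 positions.

open import Defs
open import Data.Bool using (Bool; true; false; not; if_then_else_)
open import Data.Bool.Properties using (T-≡)
open import Data.Empty using (⊥-elim)
open import Data.List using (List; []; _∷_; _++_; [_]; applyUpTo; filterᵇ; take; length)
open import Data.List.Properties using (length-++; ++-assoc; applyUpTo-∷ʳ; filter-++)
open import Data.List.Membership.Propositional using (_∈_)
open import Data.List.Membership.Propositional.Properties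
  using (∈-∃++; ∈-++⁺ˡ; ∈-++⁺ʳ; ∈-++⁻; ∈-insert; ∈-filter⁺; ∈-applyUpTo⁺; ∈-applyUpTo⁻)
open import Data.List.Relation.Unary.Any using (here; there)
open import Data.List.Relation.Binary.Permutation.Propositional using (_↭_; prep; ↭-refl; ↭-sym; ↭-trans)
open import Data.List.Relation.Binary.Permutation.Propositional.Properties using (shift; ∈-resp-↭; ++⁺ʳ)
open import Data.Nat using (ℕ; zero; suc; _+_; _*_; _∸_; _≤_; _<_; _<ᵇ_; z≤n; s≤s; _≤?_)
open import Data.Nat.Properties
open import Data.Product using (Σ; ∃; _×_; _,_; proj₁; proj₂)
open import Data.Sum using (inj₁; inj₂)
open import Function using (_∘_)
open import Function.Bundles using (Equivalence)
open import Relation.Nullary using (¬_; yes; no)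
open import Relation.Nullary.Decidable using (T?)
open import Relation.Binary.PropositionalEquality hiding ([_])

private variable
  A : Set

take-++-≤ : ∀ {m} (xs ys : List A) → m ≤ length xs → take m (xs ++ ys) ≡ take m xs
take-++-≤ {m = zero}  xs       ys _         = refl
take-++-≤ {m = suc m} (x ∷ xs) ys (s≤s m≤) = cong (x ∷_) (take-++-≤ xs ys m≤)

take-++-length : ∀ {m} (xs ys : List A) → length xs ≡ m → take m (xs ++ ys) ≡ xs
take-++-length []       ys refl = refl
take-++-length (x ∷ xs) ys refl = cong (x ∷_) (take-++-length xs ys refl)

split-last : ∀ (xs : List A) {m} → length xs ≡ suc m →
  ∃ λ ys → ∃ λ y → xs ≡ ys ++ [ y ] × length ys ≡ m
split-last (x ∷ [])     {zero}  refl = [] , x , refl , refl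
split-last (x ∷ xs)     {suc m} |xs|
  with ys , y , refl , |ys| ← split-last xs (suc-injective |xs|) = x ∷ ys , y , refl , cong suc |ys|

split-last-two : ∀ (xs : List A) {m} → length xs ≡ suc (suc m) →
  ∃ λ ys → ∃ λ y → ∃ λ z → xs ≡ ys ++ y ∷ z ∷ [] × length ys ≡ m
split-last-two xs |xs|
  with ys′ , z , refl , |ys′| ← split-last xs |xs|
  with ys , y , refl , |ys| ← split-last ys′ |ys′| = ys , y , z , ++-assoc ys [ y ] [ z ] , |ys|

applyUpTo-+ : ∀ (f : ℕ → A) m n → applyUpTo f (m + n) ≡ applyUpTo f m ++ applyUpTo (f ∘ (m +_)) n
applyUpTo-+ f zero    n = refl
applyUpTo-+ f (suc m) n = cong (f 0 ∷_) (applyUpTo-+ (f ∘ suc) m n)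

filterᵇ-complement-↭ : ∀ (P : A → Bool) xs → filterᵇ P xs ++ filterᵇ (not ∘ P) xs ↭ xs
filterᵇ-complement-↭ P [] = ↭-refl
filterᵇ-complement-↭ P (x ∷ xs) with P x
... | true  = prep x (filterᵇ-complement-↭ P xs)
... | false = ↭-trans (shift x (filterᵇ P xs) _) (prep x (filterᵇ-complement-↭ P xs))

data Precedes {A : Set} : List A → A → A → Set where
  before : ∀ {x y xs} → y ∈ xs → Precedes (x ∷ xs) x y
  skip   : ∀ {z x y xs} → Precedes xs x y → Precedes (z ∷ xs) x y

Precedes⇒Above : ∀ {σ x y} → Precedes σ x y → Above σ x y
Precedes⇒Above (before y∈xs) with _ , _ , refl ← ∈-∃++ y∈xs = [] , _ , _ , refl
Precedes⇒Above {z ∷ _} (skip p) with ps , qs , rs , refl ← Precedes⇒Above p = z ∷ ps , qs , rs , refl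

precedes-++⁺ˡ : ∀ {xs x y} (ys : List A) → Precedes xs x y → Precedes (xs ++ ys) x y
precedes-++⁺ˡ ys (before y∈) = before (∈-++⁺ˡ y∈)
precedes-++⁺ˡ ys (skip p)    = skip (precedes-++⁺ˡ ys p)

precedes-++⁺ʳ : ∀ (xs : List A) {ys x y} → Precedes ys x y → Precedes (xs ++ ys) x y
precedes-++⁺ʳ []       p = p
precedes-++⁺ʳ (_ ∷ xs) p = skip (precedes-++⁺ʳ xs p)

precedes-++⁺ : ∀ {xs ys : List A} {x y} → x ∈ xs → y ∈ ys → Precedes (xs ++ ys) x y
precedes-++⁺ {xs = _ ∷ xs} (here refl) y∈ = before (∈-++⁺ʳ xs y∈)
precedes-++⁺               (there x∈)  y∈ = skip (precedes-++⁺ x∈ y∈)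

precedes-++⁻ʳ : ∀ (xs : List A) {ys x y} → ¬ x ∈ xs → Precedes (xs ++ ys) x y → Precedes ys x y
precedes-++⁻ʳ []       _   p           = p
precedes-++⁻ʳ (_ ∷ xs) x∉ (before _) = ⊥-elim (x∉ (here refl))
precedes-++⁻ʳ (_ ∷ xs) x∉ (skip p)   = precedes-++⁻ʳ xs (x∉ ∘ there) p

precedes-filterᵇ⁺ : ∀ (P : A → Bool) {xs x y} → Precedes xs x y → P x ≡ true → P y ≡ true →
  Precedes (filterᵇ P xs) x y
precedes-filterᵇ⁺ P (before y∈) Px Py rewrite Px =
  before (∈-filter⁺ (T? ∘ P) y∈ (Equivalence.from T-≡ Py))
precedes-filterᵇ⁺ P (skip {z} p) Px Py with P z
... | true  = skip (precedes-filterᵇ⁺ P p Px Py)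
... | false = precedes-filterᵇ⁺ P p Px Py

precedes-applyUpTo⁺ : ∀ (f : ℕ → A) {i j n} → i < j → j < n → Precedes (applyUpTo f n) (f i) (f j)
precedes-applyUpTo⁺ f {zero}  {suc j} {suc n} _         (s≤s j<n) = before (∈-applyUpTo⁺ (f ∘ suc) j<n)
precedes-applyUpTo⁺ f {suc i} {suc j} {suc n} (s≤s i<j) (s≤s j<n) = skip (precedes-applyUpTo⁺ (f ∘ suc) i<j j<n)

∈-range⁺ : ∀ {x n} → 1 ≤ x → x ≤ n → x ∈ range n
∈-range⁺ {suc x} _ x≤n = ∈-applyUpTo⁺ suc x≤n

∈-range⇒≤ : ∀ {x n} → x ∈ range n → x ≤ n
∈-range⇒≤ x∈ with _ , i<n , refl ← ∈-applyUpTo⁻ suc x∈ = i<n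

precedes-range⁺ : ∀ {x y n} → 1 ≤ x → x < y → y ≤ n → Precedes (range n) x y
precedes-range⁺ {suc x} {suc y} _ (s≤s x<y) y≤n = precedes-applyUpTo⁺ suc x<y y≤n

range-++ : ∀ {a b} → a ≤ b → range b ≡ range a ++ applyUpTo (λ i → suc (a + i)) (b ∸ a)
range-++ {a} {b} a≤b = trans (cong range (sym (m+[n∸m]≡n a≤b))) (applyUpTo-+ suc a (b ∸ a))

countUpTo : (ℕ → Bool) → ℕ → ℕ
countUpTo P t = length (filterᵇ P (range t))

filterᵇ-range-suc : ∀ P t → filterᵇ P (range (suc t)) ≡ filterᵇ P (range t) ++ filterᵇ P [ suc t ]
filterᵇ-range-suc P t =
  trans (cong (filterᵇ P) (sym (applyUpTo-∷ʳ suc t))) (filter-++ (T? ∘ P) (range t) [ suc t ])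

countUpTo-suc : ∀ P t → countUpTo P (suc t) ≡ countUpTo P t + length (filterᵇ P [ suc t ])
countUpTo-suc P t = trans (cong length (filterᵇ-range-suc P t)) (length-++ (filterᵇ P (range t)))

countUpTo-accept : ∀ P t → P (suc t) ≡ true → countUpTo P (suc t) ≡ suc (countUpTo P t)
countUpTo-accept P t Pt with countUpTo-suc P t
... | eq rewrite Pt = trans eq (+-comm (countUpTo P t) 1)

countUpTo-reject : ∀ P t → P (suc t) ≡ false → countUpTo P (suc t) ≡ countUpTo P t
countUpTo-reject P t Pt with countUpTo-suc P t
... | eq rewrite Pt = trans eq (+-identityʳ (countUpTo P t))

countUpTo-mono : ∀ P {a b} → a ≤ b → countUpTo P a ≤ countUpTo P b
countUpTo-mono P {a} {b} a≤b = begin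
  countUpTo P a                                     ≤⟨ m≤m+n _ _ ⟩
  countUpTo P a + length (filterᵇ P rest)           ≡⟨ length-++ (filterᵇ P (range a)) ⟨
  length (filterᵇ P (range a) ++ filterᵇ P rest)    ≡⟨ cong length (filter-++ (T? ∘ P) (range a) rest) ⟨
  length (filterᵇ P (range a ++ rest))              ≡⟨ cong (length ∘ filterᵇ P) (range-++ a≤b) ⟨
  countUpTo P b                                     ∎
  where
  open ≤-Reasoning
  rest : List ℕ
  rest = applyUpTo (λ i → suc (a + i)) (b ∸ a)

filterᵇ-range-split : ∀ (P : ℕ → Bool) {a n} → P (suc a) ≡ true → suc a ≤ n →
  ∃ λ rest → filterᵇ P (range n) ≡ filterᵇ P (range a) ++ suc a ∷ rest
filterᵇ-range-split P {a} {n} Pa a<n = filterᵇ P rest , (begin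
  filterᵇ P (range n)                                   ≡⟨ cong (filterᵇ P) (range-++ a<n) ⟩
  filterᵇ P (range (suc a) ++ rest)                     ≡⟨ filter-++ (T? ∘ P) (range (suc a)) rest ⟩
  filterᵇ P (range (suc a)) ++ filterᵇ P rest           ≡⟨ cong (_++ filterᵇ P rest) (filterᵇ-range-suc P a) ⟩
  (filterᵇ P (range a) ++ filterᵇ P [ suc a ]) ++ filterᵇ P rest
                                                        ≡⟨ ++-assoc (filterᵇ P (range a)) _ _ ⟩
  filterᵇ P (range a) ++ filterᵇ P [ suc a ] ++ filterᵇ P rest
                                                        ≡⟨ cong (λ b → filterᵇ P (range a) ++ b) accept ⟩
  filterᵇ P (range a) ++ suc a ∷ filterᵇ P rest         ∎)
  where
  open ≡-Reasoning
  rest : List ℕ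
  rest = applyUpTo (λ i → suc (suc a + i)) (n ∸ suc a)
  accept : filterᵇ P [ suc a ] ++ filterᵇ P rest ≡ suc a ∷ filterᵇ P rest
  accept rewrite Pa = refl

fill-↭ : ∀ v {xs ys} → countD v ≡ length xs → countU v ≡ length ys → fill v xs ys ↭ xs ++ ys
fill-↭ []      {[]}     {[]}     _  _  = ↭-refl
fill-↭ (d ∷ v) {x ∷ xs}          #d #u = prep x (fill-↭ v (suc-injective #d) #u)
fill-↭ (u ∷ v) {xs}     {y ∷ ys} #d #u =
  ↭-trans (prep y (fill-↭ v #d (suc-injective #u))) (↭-sym (shift y xs ys))

length-fill : ∀ v {xs ys} → countD v ≡ length xs → countU v ≡ length ys → length (fill v xs ys) ≡ length v
length-fill []      _  _  = refl
length-fill (d ∷ v) {x ∷ xs}          #d #u = cong suc (length-fill v (suc-injective #d) #u)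
length-fill (u ∷ v) {xs}     {y ∷ ys} #d #u = cong suc (length-fill v #d (suc-injective #u))

∈-fillˣ : ∀ v {xs ys x} → countD v ≡ length xs → countU v ≡ length ys → x ∈ xs → x ∈ fill v xs ys
∈-fillˣ v #d #u x∈ = ∈-resp-↭ (↭-sym (fill-↭ v #d #u)) (∈-++⁺ˡ x∈)

∈-fillʸ : ∀ v {xs ys y} → countD v ≡ length xs → countU v ≡ length ys → y ∈ ys → y ∈ fill v xs ys
∈-fillʸ v {xs} #d #u y∈ = ∈-resp-↭ (↭-sym (fill-↭ v #d #u)) (∈-++⁺ʳ xs y∈)

precedes-fillˣ : ∀ v {xs ys x x′} → countD v ≡ length xs → countU v ≡ length ys →
  Precedes xs x x′ → Precedes (fill v xs ys) x x′
precedes-fillˣ (d ∷ v) {_ ∷ _}         #d #u (before x′∈) = before (∈-fillˣ v (suc-injective #d) #u x′∈)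
precedes-fillˣ (d ∷ v) {_ ∷ _}         #d #u (skip p)     = skip (precedes-fillˣ v (suc-injective #d) #u p)
precedes-fillˣ (u ∷ v) {_}     {_ ∷ _} #d #u p            = skip (precedes-fillˣ v #d (suc-injective #u) p)

precedes-fillʸ : ∀ v {xs ys y y′} → countD v ≡ length xs → countU v ≡ length ys →
  Precedes ys y y′ → Precedes (fill v xs ys) y y′
precedes-fillʸ (u ∷ v) {_}     {_ ∷ _} #d #u (before y′∈) = before (∈-fillʸ v #d (suc-injective #u) y′∈)
precedes-fillʸ (u ∷ v) {_}     {_ ∷ _} #d #u (skip p)     = skip (precedes-fillʸ v #d (suc-injective #u) p)
precedes-fillʸ (d ∷ v) {_ ∷ _}         #d #u p            = skip (precedes-fillʸ v (suc-injective #d) #u p)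

countU-++ : ∀ p q → countU (p ++ q) ≡ countU p + countU q
countU-++ []      q = refl
countU-++ (u ∷ p) q = cong suc (countU-++ p q)
countU-++ (d ∷ p) q = countU-++ p q

countD-++ : ∀ p q → countD (p ++ q) ≡ countD p + countD q
countD-++ []      q = refl
countD-++ (u ∷ p) q = countD-++ p q
countD-++ (d ∷ p) q = cong suc (countD-++ p q)

countU+countD≡length : ∀ w → countU w + countD w ≡ length w
countU+countD≡length []      = refl
countU+countD≡length (u ∷ w) = cong suc (countU+countD≡length w)
countU+countD≡length (d ∷ w) = trans (+-suc (countU w) (countD w)) (cong suc (countU+countD≡length w))

Ballot : ℕ → List Letter → Set
Ballot c w = ∀ p q → w ≡ p ++ q → countD p ≤ c + countU p

ballot-∷u : ∀ {c w} → Ballot c (u ∷ w) → Ballot (suc c) w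
ballot-∷u {c} b p q refl = subst (countD p ≤_) (+-suc c (countU p)) (b (u ∷ p) q refl)

ballot-∷d : ∀ {c w} → Ballot (suc c) (d ∷ w) → Ballot c w
ballot-∷d b p q refl = ≤-pred (b (d ∷ p) q refl)

¬ballot-zero-∷d : ∀ {w} → ¬ Ballot 0 (d ∷ w)
¬ballot-zero-∷d b with () ← b [ d ] _ refl

ballot-++⁻ˡ : ∀ {c} w {r} → Ballot c (w ++ r) → Ballot c w
ballot-++⁻ˡ w {r} b p q refl = b p (q ++ r) (++-assoc p q r)

ballot-suffix : ∀ c p r → Ballot c (p ++ r) → countU (p ++ r) ≡ countD (p ++ r) → countU r ≤ c + countD r
ballot-suffix c p r b balanced = +-cancelˡ-≤ (countU p) (countU r) (c + countD r) (begin
  countU p + countU r         ≡⟨ countU-++ p r ⟨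
  countU (p ++ r)             ≡⟨ balanced ⟩
  countD (p ++ r)             ≡⟨ countD-++ p r ⟩
  countD p + countD r         ≤⟨ +-monoˡ-≤ (countD r) (b p r refl) ⟩
  (c + countU p) + countD r   ≡⟨ cong (_+ countD r) (+-comm c (countU p)) ⟩
  (countU p + c) + countD r   ≡⟨ +-assoc (countU p) c (countD r) ⟩
  countU p + (c + countD r)   ∎)
  where open ≤-Reasoning

ballot-penultimate : ∀ v {a b} → Ballot 1 (v ++ a ∷ b ∷ []) → countU (v ++ a ∷ b ∷ []) ≡ countD (v ++ a ∷ b ∷ []) →
  countU (v ++ a ∷ b ∷ []) ≤ suc (countU v)
ballot-penultimate v {u} {u} ballot balanced = ⊥-elim (1+n≰n (ballot-suffix 1 v (u ∷ u ∷ []) ballot balanced))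
ballot-penultimate v {u} {d} _ _ = ≤-reflexive (trans (countU-++ v _) (+-comm (countU v) 1))
ballot-penultimate v {d} {u} _ _ = ≤-reflexive (trans (countU-++ v _) (+-comm (countU v) 1))
ballot-penultimate v {d} {d} _ _ = ≤-trans (≤-reflexive (trans (countU-++ v _) (+-identityʳ _))) (n≤1+n _)

countU-take-penultimate : ∀ {m} v → Ballot 1 v → countU v ≡ countD v → length v ≡ suc (suc m) →
  countU v ≤ suc (countU (take m v))
countU-take-penultimate v ballot balanced |v|
  with v₁ , a , b , refl , |v₁| ← split-last-two v |v|
  rewrite take-++-length v₁ (a ∷ b ∷ []) |v₁| = ballot-penultimate v₁ ballot balanced

precedes-fillʸˣ : ∀ {c} v {xs ys xs₁ x xs₂ ys₁ y ys₂} → xs ≡ xs₁ ++ x ∷ xs₂ → ys ≡ ys₁ ++ y ∷ ys₂ →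
  Ballot c v → countD v ≡ length xs → countU v ≡ length ys → c + length ys₁ ≤ length xs₁ →
  Precedes (fill v xs ys) y x
precedes-fillʸˣ []      {ys₁ = []}    refl refl _ _ () _
precedes-fillʸˣ []      {ys₁ = _ ∷ _} refl refl _ _ () _
precedes-fillʸˣ (u ∷ v) {xs₁ = xs₁} {ys₁ = []} refl refl _ #d #u _ =
  before (∈-fillˣ v #d (suc-injective #u) (∈-insert xs₁))
precedes-fillʸˣ {c} (u ∷ v) {xs₁ = xs₁} {ys₁ = _ ∷ ys₁} refl refl b #d #u le =
  skip (precedes-fillʸˣ v refl refl (ballot-∷u b) #d (suc-injective #u) (subst (_≤ length xs₁) (+-suc c (length ys₁)) le))
precedes-fillʸˣ {zero}  (d ∷ v) refl refl b _ _ _ = ⊥-elim (¬ballot-zero-∷d b)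
precedes-fillʸˣ {suc c} (d ∷ v) {xs₁ = []}    refl refl _ _ _ ()
precedes-fillʸˣ {suc c} (d ∷ v) {xs₁ = _ ∷ _} refl refl b #d #u le =
  skip (precedes-fillʸˣ v refl refl (ballot-∷d b) (suc-injective #d) #u (≤-pred le))

∈-take-fillʸ : ∀ m v {xs ys ys₁ y ys₂} → ys ≡ ys₁ ++ y ∷ ys₂ → countD v ≡ length xs → countU v ≡ length ys →
  length ys₁ < countU (take m v) → y ∈ take m (fill v xs ys)
∈-take-fillʸ (suc m) (d ∷ v) {_ ∷ _} refl #d #u lt = there (∈-take-fillʸ m v refl (suc-injective #d) #u lt)
∈-take-fillʸ (suc m) (u ∷ v) {ys₁ = []}    refl #d #u lt = here refl
∈-take-fillʸ (suc m) (u ∷ v) {ys₁ = _ ∷ _} refl #d #u lt =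
  there (∈-take-fillʸ m v refl #d (suc-injective #u) (≤-pred lt))

dyck-interior : ∀ {m} w → IsDyck w → length w ≡ suc (suc m) → ∃ λ v → w ≡ u ∷ v ++ [ d ] × length v ≡ m
dyck-interior (d ∷ w) (_ , ballot) _ = ⊥-elim (¬ballot-zero-∷d ballot)
dyck-interior (u ∷ w) (balanced , ballot) |w| with split-last w (suc-injective |w|)
... | v , u , refl , _   = ⊥-elim (1+n≰n (ballot-suffix 0 (u ∷ v) [ u ] ballot balanced))
... | v , d , refl , |v| = v , refl , |v|

dyck-interior-balanced : ∀ v → IsDyck (u ∷ v ++ [ d ]) → countU v ≡ countD v
dyck-interior-balanced v (balanced , _) = suc-injective (begin
  suc (countU v)            ≡⟨ cong suc (trans (countU-++ v [ d ]) (+-identityʳ _)) ⟨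
  suc (countU (v ++ [ d ])) ≡⟨ balanced ⟩
  countD (v ++ [ d ])       ≡⟨ countD-++ v [ d ] ⟩
  countD v + 1              ≡⟨ +-comm (countD v) 1 ⟩
  suc (countD v)            ∎)
  where open ≡-Reasoning

dyck-interior-ballot : ∀ v → IsDyck (u ∷ v ++ [ d ]) → Ballot 1 v
dyck-interior-ballot v (_ , ballot) = ballot-++⁻ˡ v (ballot-∷u {w = v ++ [ d ]} ballot)

double : ℕ → ℕ
double zero    = zero
double (suc q) = suc (suc (double q))

double[n]≡2*n : ∀ q → double q ≡ 2 * q
double[n]≡2*n zero    = refl
double[n]≡2*n (suc q) = cong suc (trans (cong suc (double[n]≡2*n q)) (sym (+-suc q (q + 0))))

m+m≡double[n]⇒m≡n : ∀ m n → m + m ≡ double n → m ≡ n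
m+m≡double[n]⇒m≡n zero    zero    _  = refl
m+m≡double[n]⇒m≡n (suc m) (suc n) eq =
  cong suc (m+m≡double[n]⇒m≡n m n (suc-injective (trans (sym (+-suc m m)) (suc-injective eq))))

data DoubleView : ℕ → Set where
  even : ∀ q → DoubleView (double q)
  odd  : ∀ q → DoubleView (suc (double q))

doubleView : ∀ t → DoubleView t
doubleView zero = even 0
doubleView (suc t) with doubleView t
... | even q = odd q
... | odd q  = even (suc q)

isEven-double : ∀ q → isEven (double q) ≡ true
isEven-double zero    = refl
isEven-double (suc q) = isEven-double q

isEven-suc-double : ∀ q → isEven (suc (double q)) ≡ false
isEven-suc-double zero    = refl
isEven-suc-double (suc q) = isEven-suc-double q

double-gap : ∀ {q m} → double q < double m → double (suc q) ≤ double m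
double-gap {zero}  {suc m} _                  = s≤s (s≤s z≤n)
double-gap {suc q} {suc m} (s≤s (s≤s dq<dm)) = s≤s (s≤s (double-gap dq<dm))

even-gap : ∀ {N q} → isEven N ≡ true → double q < N → double (suc q) ≤ N
even-gap {N} N-even dq<N with doubleView N
... | even m = double-gap dq<N
... | odd m with () ← trans (sym N-even) (isEven-suc-double m)

1+n<ᵇn : ∀ n → (suc n <ᵇ n) ≡ false
1+n<ᵇn zero    = refl
1+n<ᵇn (suc n) = 1+n<ᵇn n

notA : ℕ → ℕ → Bool
notA m x = not (inA m x)

∸2≤boundA : ∀ m → m ∸ 2 ≤ boundA m
∸2≤boundA m with isEven m
... | true  = ≤-refl
... | false = ∸-monoʳ-≤ m (s≤s z≤n)

inA-even : ∀ m q → double (suc q) ≤ boundA m → inA m (double (suc q)) ≡ true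
inA-even m q le rewrite isEven-double q = Equivalence.to T-≡ (≤⇒≤ᵇ le)

inA-odd : ∀ m {q} → 1 ≤ q → inA m (suc (double q)) ≡ false
inA-odd m {suc q} _ rewrite isEven-suc-double q = refl

inA-top : ∀ k → inA (double (suc k)) (double (suc k)) ≡ false
inA-top k rewrite isEven-double k = 1+n<ᵇn (double k)

module CountsInA (N : ℕ) (N-even : isEven N ≡ true) where

  even<⇒≤∸2 : ∀ {q} → double (suc q) < N → double (suc q) ≤ N ∸ 2
  even<⇒≤∸2 lt = ∸-monoˡ-≤ 2 (even-gap N-even lt)

  inA-even< : ∀ {q} → double (suc q) < N → inA N (double (suc q)) ≡ true
  inA-even< {q} lt rewrite isEven-double q | N-even = Equivalence.to T-≡ (≤⇒≤ᵇ (even<⇒≤∸2 lt))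

  inA-restrict : ∀ {n j} → N ≤ n → j < N → inA n j ≡ inA N j
  inA-restrict {n} {j} N≤n j<N with doubleView j
  ... | even zero    = refl
  ... | odd zero     = refl
  ... | odd (suc q)  = trans (inA-odd n (s≤s z≤n)) (sym (inA-odd N (s≤s z≤n)))
  ... | even (suc q) = trans (inA-even n q bound) (sym (inA-even< j<N))
    where
    bound : double (suc q) ≤ boundA n
    bound = ≤-trans (even<⇒≤∸2 j<N) (≤-trans (∸-monoˡ-≤ 2 N≤n) (∸2≤boundA n))

  odd-counts : ∀ q → suc (double q) < N →
    countUpTo (inA N) (suc (double q)) ≡ suc q × countUpTo (notA N) (suc (double q)) ≡ q
  odd-counts zero    _  = refl , refl
  odd-counts (suc q) lt = (begin
      countUpTo (inA N) (suc (double (suc q)))  ≡⟨ countUpTo-reject (inA N) (double (suc q)) (inA-odd N (s≤s z≤n)) ⟩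
      countUpTo (inA N) (double (suc q))        ≡⟨ countUpTo-accept (inA N) (suc (double q)) A-even ⟩
      suc (countUpTo (inA N) (suc (double q)))  ≡⟨ cong suc (proj₁ counts) ⟩
      suc (suc q)                               ∎)
    , (begin
      countUpTo (notA N) (suc (double (suc q))) ≡⟨ countUpTo-accept (notA N) (double (suc q)) (cong not (inA-odd N (s≤s z≤n))) ⟩
      suc (countUpTo (notA N) (double (suc q))) ≡⟨ cong suc (countUpTo-reject (notA N) (suc (double q)) (cong not A-even)) ⟩
      suc (countUpTo (notA N) (suc (double q))) ≡⟨ cong suc (proj₂ counts) ⟩
      suc q                                     ∎)
    where
    open ≡-Reasoning
    A-even : inA N (double (suc q)) ≡ true
    A-even = inA-even< (≤-trans (n≤1+n _) lt)
    counts : countUpTo (inA N) (suc (double q)) ≡ suc q × countUpTo (notA N) (suc (double q)) ≡ q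
    counts = odd-counts q (≤-trans (n≤1+n _) (≤-trans (n≤1+n _) lt))

  countUpTo-notA<inA : ∀ {t} → 1 ≤ t → t < N → countUpTo (notA N) t < countUpTo (inA N) t
  countUpTo-notA<inA {t} 1≤t t<N with doubleView t
  ... | odd q = begin-strict
    countUpTo (notA N) (suc (double q)) ≡⟨ proj₂ (odd-counts q t<N) ⟩
    q                                   <⟨ n<1+n q ⟩
    suc q                               ≡⟨ proj₁ (odd-counts q t<N) ⟨
    countUpTo (inA N) (suc (double q))  ∎
    where open ≤-Reasoning
  ... | even (suc q) = begin-strict
    countUpTo (notA N) (double (suc q))       ≡⟨ countUpTo-reject (notA N) (suc (double q)) (cong not (inA-even< t<N)) ⟩
    countUpTo (notA N) (suc (double q))       ≡⟨ proj₂ (odd-counts q (≤-trans (n≤1+n _) t<N)) ⟩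
    q                                         <⟨ m≤n⇒m≤1+n (n<1+n q) ⟩
    suc (suc q)                               ≡⟨ cong suc (proj₁ (odd-counts q (≤-trans (n≤1+n _) t<N))) ⟨
    suc (countUpTo (inA N) (suc (double q)))  ≡⟨ countUpTo-accept (inA N) (suc (double q)) (inA-even< t<N) ⟨
    countUpTo (inA N) (double (suc q))        ∎
    where open ≤-Reasoning
  countUpTo-notA<inA () _ | even zero

  countUpTo-notA-double : ∀ {q} → 1 ≤ q → double q < N → countUpTo (notA N) (double q) < q
  countUpTo-notA-double {suc q} _ lt = ≤-reflexive (cong suc (begin
    countUpTo (notA N) (double (suc q))  ≡⟨ countUpTo-reject (notA N) (suc (double q)) (cong not (inA-even< lt)) ⟩
    countUpTo (notA N) (suc (double q))  ≡⟨ proj₂ (odd-counts q (≤-trans (n≤1+n _) lt)) ⟩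
    q                                    ∎))
    where open ≡-Reasoning

NeverCondition : Bool → List ℕ → ℕ → ℕ → ℕ → Set
NeverCondition b σ i j l = if b then OneN3 σ i j l else ThreeN1 σ i j l

above⇒NeverCondition : ∀ b {σ i j l} → Above σ i l → NeverCondition b σ i j l
above⇒NeverCondition true  above = inj₂ above
above⇒NeverCondition false above = inj₁ above

-- k is the paper's k − 1: N is the paper's 2k and v is a_1 ⋯ a_{2k}.
module Witness (n k : ℕ) (N≤n : double (suc k) ≤ n) (v : List Letter) (|v| : length v ≡ double (suc k))
               (balanced : countU v ≡ countD v) (ballot : Ballot 1 v) where

  N : ℕ
  N = double (suc k)

  open CountsInA N (isEven-double (suc k))

  s tail σ : List ℕ
  s    = fill v (listA N) (listNotA N)
  tail = applyUpTo (λ i → suc (N + i)) (n ∸ N)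
  σ    = s ++ tail

  #u≡k : countU v ≡ suc k
  #u≡k = m+m≡double[n]⇒m≡n (countU v) (suc k)
           (trans (cong (countU v +_) balanced) (trans (countU+countD≡length v) |v|))

  #d : countD v ≡ length (listA N)
  #d = begin
    countD v                                ≡⟨ trans (sym balanced) #u≡k ⟩
    suc k                                   ≡⟨ proj₁ (odd-counts k ≤-refl) ⟨
    countUpTo (inA N) (suc (double k))      ≡⟨ countUpTo-reject (inA N) (suc (double k)) (inA-top k) ⟨
    countUpTo (inA N) N                     ∎
    where open ≡-Reasoning

  #u : countU v ≡ length (listNotA N)
  #u = begin
    countU v                                ≡⟨ #u≡k ⟩
    suc k                                   ≡⟨ cong suc (proj₂ (odd-counts k ≤-refl)) ⟨
    suc (countUpTo (notA N) (suc (double k))) ≡⟨ countUpTo-accept (notA N) (suc (double k)) (cong not (inA-top k)) ⟨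
    countUpTo (notA N) N                    ∎
    where open ≡-Reasoning

  |s| : length s ≡ N
  |s| = trans (length-fill v #d #u) |v|

  range-n≡ : range n ≡ range N ++ tail
  range-n≡ = range-++ N≤n

  s↭ : s ↭ range N
  s↭ = ↭-trans (fill-↭ v #d #u) (filterᵇ-complement-↭ (inA N) (range N))

  σ-linear : IsLinearOrder n σ
  σ-linear = subst (σ ↭_) (sym range-n≡) (++⁺ʳ tail s↭)

  take-σ : take N σ ≡ s
  take-σ = take-++-length s tail |s|

  take-σ-↭ : take N σ ↭ range N
  take-σ-↭ = subst (_↭ range N) (sym take-σ) s↭

  -- N − 1 is the k-th entry of listNotA N, and the first double k letters of v contain at least
  -- k letters u because its last two letters are not both u.
  ¬take-σ-↭ : 1 ≤ k → ¬ (take (double k) σ ↭ range (double k))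
  ¬take-σ-↭ 1≤k perm = 1+n≰n (∈-range⇒≤ (∈-resp-↭ perm (subst (suc (double k) ∈_) (sym take≡) M∈)))
    where
    take≡ : take (double k) σ ≡ take (double k) s
    take≡ = take-++-≤ s tail (≤-trans (m≤n+m (double k) 2) (≤-reflexive (sym |s|)))
    k≤ : k ≤ countU (take (double k) v)
    k≤ = ≤-pred (subst (_≤ suc (countU (take (double k) v))) #u≡k (countU-take-penultimate v ballot balanced |v|))
    M∈ : suc (double k) ∈ take (double k) s
    M∈ = ∈-take-fillʸ (double k) v (proj₂ (filterᵇ-range-split (notA N) (cong not (inA-odd N 1≤k)) (n≤1+n _)))
           #d #u (<-≤-trans (countUpTo-notA-double 1≤k (n≤1+n _)) k≤)

  precedes-A : ∀ {x y} → 1 ≤ x → x < y → y ≤ N → inA N x ≡ true → inA N y ≡ true → Precedes s x y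
  precedes-A 1≤x x<y y≤N Px Py =
    precedes-fillˣ v #d #u (precedes-filterᵇ⁺ (inA N) (precedes-range⁺ 1≤x x<y y≤N) Px Py)

  precedes-notA : ∀ {x y} → 1 ≤ x → x < y → y ≤ N → notA N x ≡ true → notA N y ≡ true → Precedes s x y
  precedes-notA 1≤x x<y y≤N Qx Qy =
    precedes-fillʸ v #d #u (precedes-filterᵇ⁺ (notA N) (precedes-range⁺ 1≤x x<y y≤N) Qx Qy)

  -- If x has index i in listA N, the ballot property puts at least i letters u before it in v,
  -- and y has index below i in listNotA N.
  precedes-notA-A : ∀ {y x} → 1 ≤ y → y < x → x ≤ N → notA N y ≡ true → inA N x ≡ true → Precedes s y x
  precedes-notA-A {suc (suc y′)} {suc x′} _ y<x x≤N Qy Px =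
    precedes-fillʸˣ v (proj₂ (filterᵇ-range-split (inA N) Px x≤N))
                      (proj₂ (filterᵇ-range-split (notA N) Qy y≤N))
                      ballot #d #u
                      (<-≤-trans (countUpTo-notA<inA (s≤s z≤n) y≤N) (countUpTo-mono (inA N) (<⇒≤ (≤-pred y<x))))
    where
    y≤N : suc (suc y′) ≤ N
    y≤N = ≤-trans (<⇒≤ y<x) x≤N

  above-in-s : ∀ {x y} → Precedes s x y → Above σ x y
  above-in-s = Precedes⇒Above ∘ precedes-++⁺ˡ tail

  never-below-N : ∀ {i j l} → 1 ≤ i → i < j → j < l → l ≤ N → NeverCondition (inA N j) σ i j l
  never-below-N {i} {j} {l} 1≤i i<j j<l l≤N with inA N j in Pj
  ... | true with inA N i in Pi
  ...   | true  = inj₁ (above-in-s (precedes-A 1≤i i<j (≤-trans (<⇒≤ j<l) l≤N) Pi Pj))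
  ...   | false = inj₁ (above-in-s (precedes-notA-A 1≤i i<j (≤-trans (<⇒≤ j<l) l≤N) (cong not Pi) Pj))
  never-below-N {i} {j} {l} 1≤i i<j j<l l≤N | false with inA N l in Pl
  ...   | true  = inj₂ (above-in-s (precedes-notA-A (≤-trans 1≤i (<⇒≤ i<j)) j<l l≤N (cong not Pj) Pl))
  ...   | false = inj₂ (above-in-s (precedes-notA (≤-trans 1≤i (<⇒≤ i<j)) j<l l≤N (cong not Pj) (cong not Pl)))

  ∈-tail : ∀ {l} → N < l → l ≤ n → l ∈ tail
  ∈-tail N<l l≤n with ∈-++⁻ (range N) (subst (_ ∈_) range-n≡ (∈-range⁺ (≤-trans (s≤s z≤n) N<l) l≤n))
  ... | inj₁ l∈ = ⊥-elim (<⇒≱ N<l (∈-range⇒≤ l∈))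
  ... | inj₂ l∈ = l∈

  above-tail : ∀ {i l} → 1 ≤ i → i < l → N < l → l ≤ n → Above σ i l
  above-tail {i} 1≤i i<l N<l l≤n with i ≤? N
  ... | yes i≤N = Precedes⇒Above (precedes-++⁺ (∈-resp-↭ (↭-sym s↭) (∈-range⁺ 1≤i i≤N)) (∈-tail N<l l≤n))
  ... | no  i≰N = Precedes⇒Above (precedes-++⁺ʳ s (precedes-++⁻ʳ (range N) (i≰N ∘ ∈-range⇒≤)
                    (subst (λ xs → Precedes xs i _) range-n≡ (precedes-range⁺ 1≤i i<l l≤n))))

  σ-never : ∀ i j l → 1 ≤ i → i < j → j < l → l ≤ n → NeverCondition (inA n j) σ i j l
  σ-never i j l 1≤i i<j j<l l≤n with l ≤? N
  ... | no  l≰N = above⇒NeverCondition (inA n j) (above-tail 1≤i (<-trans i<j j<l) (≰⇒> l≰N) l≤n)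
  ... | yes l≤N rewrite inA-restrict N≤n (<-≤-trans j<l l≤N) = never-below-N 1≤i i<j j<l l≤N

mainTheorem14 : (n k : ℕ) → 2 ≤ n → 1 ≤ k → 2 * k ≤ n →
    (w : List Letter) → length w ≡ 2 * (k + 1) → IsDyck w →
    Σ (List ℕ) λ σ → InD n (inA n) σ × InKthPart k σ × (take (2 * k) σ ≡ seqS k w)
mainTheorem14 n (suc k) _ _ 2k≤n w |w| dyck with dyck-interior w dyck |w|′
  where
  |w|′ : length w ≡ suc (suc (double (suc k)))
  |w|′ = trans |w| (trans (sym (double[n]≡2*n (suc k + 1))) (cong double (+-comm (suc k) 1)))
... | v , refl , |v| =
  σ , (σ-linear , σ-never) , (subst (λ m → take m σ ↭ range m) N≡ take-σ-↭ , ¬take-σ-↭′) ,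
  subst (λ m → take m σ ≡ fill (take m (v ++ [ d ])) (listA m) (listNotA m)) N≡ seq
  where
  N≡ : double (suc k) ≡ 2 * suc k
  N≡ = double[n]≡2*n (suc k)
  open Witness n k (subst (_≤ n) (sym N≡) 2k≤n) v |v| (dyck-interior-balanced v dyck) (dyck-interior-ballot v dyck)
  ¬take-σ-↭′ : 2 ≤ suc k → ¬ (take (2 * k) σ ↭ range (2 * k))
  ¬take-σ-↭′ (s≤s 1≤k) = subst (λ m → ¬ (take m σ ↭ range m)) (double[n]≡2*n k) (¬take-σ-↭ 1≤k)
  seq : take N σ ≡ fill (take N (v ++ [ d ])) (listA N) (listNotA N)
  seq = trans take-σ (cong (λ x → fill x (listA N) (listNotA N)) (sym (take-++-length v [ d ] |v|)))
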